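{- Suppose $p>3$ is a prime and $f\ge1$. Let $\underline a=(a_0,\dots,a_{f-1}),\underline b=(b_0,\dots,b_{f-1})\in\mathbb Z^f$ with $a_j\in\{ -1,0,1\}$ for all $j$, $\sum_{j=0}^{f-1}|a_j|\ge\sum_{j=0}^{f-1}|b_j|$, and \[\sum_{j=0}^{f-1}a_jp^j\equiv\sum_{j=0}^{f-1}b_jp^j\pmod{p^f-1}.\] Then $\underline a=\underline b$. -}

module Defs where

open import Data.Nat using (ℕ; zero; suc)
open import Data.Fin using (Fin; toℕ)
import Data.Fin as Fin
open import Data.Integer using (ℤ; +_; _+_; _*_; _-_; ∣_∣; -1ℤ; 0ℤ; 1ℤ; _^_)
open import Data.Integer.Divisibility using (_∣_)
open import Relation.Binary.PropositionalEquality using (_≡_)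
open import Data.Sum using (_⊎_)

Σℤ : (n : ℕ) → (Fin n → ℤ) → ℤ
Σℤ zero    g = 0ℤ
Σℤ (suc n) g = g Fin.zero + Σℤ n (λ j → g (Fin.suc j))

Σℕ : (n : ℕ) → (Fin n → ℕ) → ℕ
Σℕ zero    g = 0
Σℕ (suc n) g = g Fin.zero Data.Nat.+ Σℕ n (λ j → g (Fin.suc j))

pexp : (p f : ℕ) → (Fin f → ℤ) → ℤ
pexp p f a = Σℤ f (λ j → a j * (+ p) ^ toℕ j)

_≡_[modℤ_] : ℤ → ℤ → ℤ → Set
x ≡ y [modℤ m ] = m ∣ (x - y)

IsSign : ℤ → Set
IsSign x = (x ≡ -1ℤ) ⊎ ((x ≡ 0ℤ) ⊎ (x ≡ 1ℤ))

-- Write c = a - b. If Σ c_j p^j = q (p^f - 1), the carries of this "subtraction" give integers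
-- x_0, …, x_f with c_j = p x_{j+1} - x_j and x_0 = x_f = q. Since a_j ∈ {-1,0,1} and p ≥ 4,
-- |a_j| + 2|x_{j+1}| ≤ |a_j - p x_{j+1}| = |b_j - x_j| ≤ |b_j| + |x_j| for every digit, and
-- summing over j telescopes (as x_0 = x_f) to Σ|a| + Σ_{j≥1} |x_j| ≤ Σ|b|. Hence Σ|b| ≤ Σ|a|
-- forces all carries to vanish, and then c = 0.

{-# OPTIONS --safe #-}
module Submission where

open import Defs
open import Data.Nat using (ℕ; _>_; _≥_)
open import Data.Nat.Primality using (Prime)
open import Data.Fin using (Fin)
open import Data.Integer using (ℤ; +_; _-_; ∣_∣; 1ℤ; _^_)
open import Relation.Binary.PropositionalEquality using (_≡_)

open import Data.Nat as ℕ using (zero; suc)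
import Data.Nat.Properties as ℕ
import Data.Nat.Tactic.RingSolver as ℕ
open import Data.Fin using (zero; suc; toℕ; inject₁; fromℕ)
open import Data.Integer using (_+_; _*_; +0; +[1+_]; -[1+_]; 0ℤ)
import Data.Integer.Properties as ℤ
open import Data.Integer.Divisibility.Signed using (_∣_; ∣ᵤ⇒∣)
open import Data.Integer.Tactic.RingSolver using (solve-∀)
open import Data.Sum using (inj₁; inj₂)
open import Function using (_∘_)
open import Relation.Binary.PropositionalEquality
  using (refl; sym; trans; cong; cong₂; module ≡-Reasoning)

Σℤ-cong : ∀ n {g h : Fin n → ℤ} → (∀ j → g j ≡ h j) → Σℤ n g ≡ Σℤ n h
Σℤ-cong zero    g≗h = refl
Σℤ-cong (suc n) g≗h = cong₂ _+_ (g≗h zero) (Σℤ-cong n (g≗h ∘ suc))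

Σℤ-*ˡ : ∀ n k (g : Fin n → ℤ) → Σℤ n (λ j → k * g j) ≡ k * Σℤ n g
Σℤ-*ˡ zero    k g = sym (ℤ.*-zeroʳ k)
Σℤ-*ˡ (suc n) k g = trans (cong (_+_ (k * g zero)) (Σℤ-*ˡ n k (g ∘ suc)))
                          (sym (ℤ.*-distribˡ-+ k (g zero) _))

Σℤ-distrib-- : ∀ n (g h : Fin n → ℤ) → Σℤ n (λ j → g j - h j) ≡ Σℤ n g - Σℤ n h
Σℤ-distrib-- zero    g h = refl
Σℤ-distrib-- (suc n) g h =
  trans (cong (_+_ (g zero - h zero)) (Σℤ-distrib-- n (g ∘ suc) (h ∘ suc)))
        (interchange (g zero) (h zero) _ _)
  where
  interchange : ∀ x y u v → (x - y) + (u - v) ≡ (x + u) - (y + v)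
  interchange = solve-∀

Σℕ≡0⇒≡0 : ∀ n (g : Fin n → ℕ) → Σℕ n g ≡ 0 → ∀ j → g j ≡ 0
Σℕ≡0⇒≡0 (suc n) g Σg≡0 zero    = ℕ.m+n≡0⇒m≡0 (g zero) Σg≡0
Σℕ≡0⇒≡0 (suc n) g Σg≡0 (suc j) = Σℕ≡0⇒≡0 n (g ∘ suc) (ℕ.m+n≡0⇒n≡0 (g zero) Σg≡0) j

pexp-suc : ∀ p n (c : Fin (suc n) → ℤ) →
           pexp p (suc n) c ≡ c zero + + p * pexp p n (c ∘ suc)
pexp-suc p n c = cong₂ _+_ (ℤ.*-identityʳ (c zero)) (begin
  Σℤ n (λ j → c (suc j) * (+ p * (+ p) ^ toℕ j))
    ≡⟨ Σℤ-cong n (λ j → *-left-comm (c (suc j)) (+ p) ((+ p) ^ toℕ j)) ⟩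
  Σℤ n (λ j → + p * (c (suc j) * (+ p) ^ toℕ j))
    ≡⟨ Σℤ-*ˡ n (+ p) _ ⟩
  + p * pexp p n (c ∘ suc) ∎)
  where
  open ≡-Reasoning
  *-left-comm : ∀ x y z → x * (y * z) ≡ y * (x * z)
  *-left-comm = solve-∀

pexp-distrib-- : ∀ p n (a b : Fin n → ℤ) →
                 pexp p n (λ j → a j - b j) ≡ pexp p n a - pexp p n b
pexp-distrib-- p n a b =
  trans (Σℤ-cong n (λ j → *-distribʳ-- (a j) (b j) _)) (Σℤ-distrib-- n _ _)
  where
  *-distribʳ-- : ∀ x y z → (x - y) * z ≡ x * z - y * z
  *-distribʳ-- = solve-∀

-- x j is the carry into digit j; telescoping gives pexp p n c = p ^ n * x n - x 0.
CarrySequence : ℕ → (n : ℕ) → (Fin n → ℤ) → (Fin (suc n) → ℤ) → Set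
CarrySequence p n c x = ∀ j → c j ≡ + p * x (suc j) - x (inject₁ j)

carries : ℕ → (n : ℕ) → (Fin n → ℤ) → ℤ → Fin (suc n) → ℤ
carries p zero    c k zero    = k
carries p (suc n) c k zero    = + p * carries p n (c ∘ suc) k zero - c zero
carries p (suc n) c k (suc j) = carries p n (c ∘ suc) k j

carries-last : ∀ p n c k → carries p n c k (fromℕ n) ≡ k
carries-last p zero    c k = refl
carries-last p (suc n) c k = carries-last p n (c ∘ suc) k

carries-head : ∀ p n c k → carries p n c k zero ≡ (+ p) ^ n * k - pexp p n c
carries-head p zero    c k = k≡1*k-0 k
  where
  k≡1*k-0 : ∀ k → k ≡ 1ℤ * k - 0ℤ
  k≡1*k-0 = solve-∀
carries-head p (suc n) c k = begin
  + p * carries p n (c ∘ suc) k zero - c zero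
    ≡⟨ cong (λ y → + p * y - c zero) (carries-head p n (c ∘ suc) k) ⟩
  + p * ((+ p) ^ n * k - pexp p n (c ∘ suc)) - c zero
    ≡⟨ regroup (+ p) ((+ p) ^ n) k (pexp p n (c ∘ suc)) (c zero) ⟩
  + p * (+ p) ^ n * k - (c zero + + p * pexp p n (c ∘ suc))
    ≡⟨ cong ((+ p) ^ suc n * k -_) (sym (pexp-suc p n c)) ⟩
  (+ p) ^ suc n * k - pexp p (suc n) c ∎
  where
  open ≡-Reasoning
  regroup : ∀ q r k s d → q * (r * k - s) - d ≡ q * r * k - (d + q * s)
  regroup = solve-∀

carries-carrySequence : ∀ p n c k → CarrySequence p n c (carries p n c k)
carries-carrySequence p (suc n) c k zero    = d≡qy-[qy-d] (c zero) (+ p) _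
  where
  d≡qy-[qy-d] : ∀ d q y → d ≡ q * y - (q * y - d)
  d≡qy-[qy-d] = solve-∀
carries-carrySequence p (suc n) c k (suc j) = carries-carrySequence p n (c ∘ suc) k j

IsSign⇒∣∣≤1 : ∀ {a} → IsSign a → ∣ a ∣ ℕ.≤ 1
IsSign⇒∣∣≤1 (inj₁ refl)        = ℕ.≤-refl
IsSign⇒∣∣≤1 (inj₂ (inj₁ refl)) = ℕ.z≤n
IsSign⇒∣∣≤1 (inj₂ (inj₂ refl)) = ℕ.≤-refl

∣a∣+2∣x∣≤∣a-px∣ : ∀ {p} → 4 ℕ.≤ p → ∀ a x → ∣ a ∣ ℕ.≤ ∣ x ∣ →
                  ∣ a ∣ ℕ.+ 2 ℕ.* ∣ x ∣ ℕ.≤ ∣ a - + p * x ∣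
∣a∣+2∣x∣≤∣a-px∣ {p} 4≤p a x ∣a∣≤∣x∣ = ℕ.+-cancelˡ-≤ ∣ a ∣ _ _ (begin
  ∣ a ∣ ℕ.+ (∣ a ∣ ℕ.+ 2 ℕ.* ∣ x ∣) ≡⟨ double-sum ∣ a ∣ ∣ x ∣ ⟩
  2 ℕ.* ∣ a ∣ ℕ.+ 2 ℕ.* ∣ x ∣        ≤⟨ ℕ.+-monoˡ-≤ (2 ℕ.* ∣ x ∣) (ℕ.*-monoʳ-≤ 2 ∣a∣≤∣x∣) ⟩
  2 ℕ.* ∣ x ∣ ℕ.+ 2 ℕ.* ∣ x ∣        ≡⟨ two-doubles ∣ x ∣ ⟩
  4 ℕ.* ∣ x ∣                        ≤⟨ ℕ.*-monoˡ-≤ ∣ x ∣ 4≤p ⟩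
  p ℕ.* ∣ x ∣                        ≡⟨ ℤ.abs-* (+ p) x ⟨
  ∣ + p * x ∣                        ≡⟨ cong ∣_∣ (a-[a-y]≡y a (+ p * x)) ⟨
  ∣ a - (a - + p * x) ∣              ≤⟨ ℤ.∣i-j∣≤∣i∣+∣j∣ a (a - + p * x) ⟩
  ∣ a ∣ ℕ.+ ∣ a - + p * x ∣          ∎)
  where
  open ℕ.≤-Reasoning
  double-sum : ∀ m n → m ℕ.+ (m ℕ.+ 2 ℕ.* n) ≡ 2 ℕ.* m ℕ.+ 2 ℕ.* n
  double-sum = ℕ.solve-∀
  two-doubles : ∀ n → 2 ℕ.* n ℕ.+ 2 ℕ.* n ≡ 4 ℕ.* n
  two-doubles = ℕ.solve-∀
  a-[a-y]≡y : ∀ a y → a - (a - y) ≡ y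
  a-[a-y]≡y = solve-∀

IsSign⇒∣a∣+2∣x∣≤∣a-px∣ : ∀ {p} → 4 ℕ.≤ p → ∀ {a} → IsSign a → ∀ x →
                         ∣ a ∣ ℕ.+ 2 ℕ.* ∣ x ∣ ℕ.≤ ∣ a - + p * x ∣
IsSign⇒∣a∣+2∣x∣≤∣a-px∣ {p} 4≤p {a} _ +0 =
  ℕ.≤-reflexive (trans (ℕ.+-identityʳ ∣ a ∣) (cong ∣_∣ (a≡a-y*0 a (+ p))))
  where
  a≡a-y*0 : ∀ a y → a ≡ a - y * 0ℤ
  a≡a-y*0 = solve-∀
IsSign⇒∣a∣+2∣x∣≤∣a-px∣ 4≤p {a} sign x@(+[1+ _ ]) =
  ∣a∣+2∣x∣≤∣a-px∣ 4≤p a x (ℕ.≤-trans (IsSign⇒∣∣≤1 sign) (ℕ.s≤s ℕ.z≤n))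
IsSign⇒∣a∣+2∣x∣≤∣a-px∣ 4≤p {a} sign x@(-[1+ _ ]) =
  ∣a∣+2∣x∣≤∣a-px∣ 4≤p a x (ℕ.≤-trans (IsSign⇒∣∣≤1 sign) (ℕ.s≤s ℕ.z≤n))

carry-digit-bound : ∀ {p} → 4 ℕ.≤ p → ∀ {a b x y} → IsSign a → a - b ≡ + p * y - x →
                    ∣ a ∣ ℕ.+ 2 ℕ.* ∣ y ∣ ℕ.≤ ∣ b ∣ ℕ.+ ∣ x ∣
carry-digit-bound {p} 4≤p {a} {b} {x} {y} sign a-b≡py-x = begin
  ∣ a ∣ ℕ.+ 2 ℕ.* ∣ y ∣ ≤⟨ IsSign⇒∣a∣+2∣x∣≤∣a-px∣ 4≤p sign y ⟩
  ∣ a - + p * y ∣       ≡⟨ cong ∣_∣ a-py≡b-x ⟩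
  ∣ b - x ∣             ≤⟨ ℤ.∣i-j∣≤∣i∣+∣j∣ b x ⟩
  ∣ b ∣ ℕ.+ ∣ x ∣       ∎
  where
  open ℕ.≤-Reasoning
  shift : ∀ a b z → a - z ≡ b + ((a - b) - z)
  shift = solve-∀
  cancel : ∀ b z x → b + ((z - x) - z) ≡ b - x
  cancel = solve-∀
  a-py≡b-x : a - + p * y ≡ b - x
  a-py≡b-x = trans (shift a b (+ p * y))
    (trans (cong (λ d → b + (d - + p * y)) a-b≡py-x) (cancel b (+ p * y) x))

carrySequence-bound : ∀ {p} → 4 ℕ.≤ p → ∀ n (a b : Fin n → ℤ) (x : Fin (suc n) → ℤ) →
  (∀ j → IsSign (a j)) → CarrySequence p n (λ j → a j - b j) x →
  Σℕ n (∣_∣ ∘ a) ℕ.+ Σℕ n (∣_∣ ∘ x ∘ suc) ℕ.+ ∣ x (fromℕ n) ∣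
    ℕ.≤ Σℕ n (∣_∣ ∘ b) ℕ.+ ∣ x zero ∣
carrySequence-bound 4≤p zero    a b x signs seq = ℕ.≤-refl
carrySequence-bound 4≤p (suc n) a b x signs seq = ℕ.+-cancelˡ-≤ ∣ x₁ ∣ _ _ (begin
  ∣ x₁ ∣ ℕ.+ (∣ a zero ∣ ℕ.+ A ℕ.+ (∣ x₁ ∣ ℕ.+ S) ℕ.+ L)
    ≡⟨ regroup (∣ x₁ ∣) (∣ a zero ∣) A S L ⟩
  (∣ a zero ∣ ℕ.+ 2 ℕ.* ∣ x₁ ∣) ℕ.+ (A ℕ.+ S ℕ.+ L)
    ≤⟨ ℕ.+-mono-≤ (carry-digit-bound 4≤p (signs zero) (seq zero))
                  (carrySequence-bound 4≤p n (a ∘ suc) (b ∘ suc) (x ∘ suc)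
                                       (signs ∘ suc) (seq ∘ suc)) ⟩
  (∣ b zero ∣ ℕ.+ ∣ x zero ∣) ℕ.+ (B ℕ.+ ∣ x₁ ∣)
    ≡⟨ regroup′ (∣ x₁ ∣) (∣ b zero ∣) B (∣ x zero ∣) ⟩
  ∣ x₁ ∣ ℕ.+ (∣ b zero ∣ ℕ.+ B ℕ.+ ∣ x zero ∣) ∎)
  where
  open ℕ.≤-Reasoning
  x₁ : ℤ
  x₁ = x (suc zero)
  A B S L : ℕ
  A = Σℕ n (∣_∣ ∘ a ∘ suc)
  B = Σℕ n (∣_∣ ∘ b ∘ suc)
  S = Σℕ n (λ j → ∣ x (suc (suc j)) ∣)
  L = ∣ x (fromℕ (suc n)) ∣
  regroup : ∀ y a A S L →
            y ℕ.+ (a ℕ.+ A ℕ.+ (y ℕ.+ S) ℕ.+ L) ≡ (a ℕ.+ 2 ℕ.* y) ℕ.+ (A ℕ.+ S ℕ.+ L)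
  regroup = ℕ.solve-∀
  regroup′ : ∀ y b B z → (b ℕ.+ z) ℕ.+ (B ℕ.+ y) ≡ y ℕ.+ (b ℕ.+ B ℕ.+ z)
  regroup′ = ℕ.solve-∀

periodic-carrySequence⇒≡ : ∀ {p} → 4 ℕ.≤ p → ∀ n (a b : Fin n → ℤ) (x : Fin (suc n) → ℤ) →
  (∀ j → IsSign (a j)) → Σℕ n (∣_∣ ∘ b) ℕ.≤ Σℕ n (∣_∣ ∘ a) →
  CarrySequence p n (λ j → a j - b j) x → x zero ≡ x (fromℕ n) →
  ∀ j → a j ≡ b j
periodic-carrySequence⇒≡ {p} 4≤p (suc n) a b x signs Σb≤Σa seq periodic j =
  ℤ.i-j≡0⇒i≡j (a j) (b j) (begin
    a j - b j
      ≡⟨ seq j ⟩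
    + p * x (suc j) - x (inject₁ j)
      ≡⟨ cong₂ (λ u v → + p * u - v) (x≡0 (suc j)) (x≡0 (inject₁ j)) ⟩
    + p * 0ℤ - 0ℤ
      ≡⟨ cong (_- 0ℤ) (ℤ.*-zeroʳ (+ p)) ⟩
    0ℤ ∎)
  where
  open ≡-Reasoning
  A S L : ℕ
  A = Σℕ (suc n) (∣_∣ ∘ a)
  S = Σℕ (suc n) (∣_∣ ∘ x ∘ suc)
  L = ∣ x (fromℕ (suc n)) ∣
  bound : A ℕ.+ S ℕ.+ L ℕ.≤ A ℕ.+ 0 ℕ.+ L
  bound = ℕ.≤-trans (carrySequence-bound 4≤p (suc n) a b x signs seq)
    (ℕ.+-mono-≤ (ℕ.≤-trans Σb≤Σa (ℕ.≤-reflexive (sym (ℕ.+-identityʳ A))))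
                (ℕ.≤-reflexive (cong ∣_∣ periodic)))
  x∘suc≡0 : ∀ i → x (suc i) ≡ 0ℤ
  x∘suc≡0 = ℤ.∣i∣≡0⇒i≡0 ∘ Σℕ≡0⇒≡0 (suc n) (∣_∣ ∘ x ∘ suc)
    (ℕ.n≤0⇒n≡0 (ℕ.+-cancelˡ-≤ A _ _ (ℕ.+-cancelʳ-≤ L _ _ bound)))
  x≡0 : ∀ i → x i ≡ 0ℤ
  x≡0 zero    = trans periodic (x∘suc≡0 (fromℕ n))
  x≡0 (suc i) = x∘suc≡0 i

lemma4p3p2 : (p f : ℕ) → Prime p → p > 3 → f ≥ 1 →
    (a b : Fin f → ℤ) →
    (∀ j → IsSign (a j)) →
    Σℕ f (λ j → ∣ a j ∣) ≥ Σℕ f (λ j → ∣ b j ∣) →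
    pexp p f a ≡ pexp p f b [modℤ ((+ p) ^ f - 1ℤ) ] →
    ∀ j → a j ≡ b j
lemma4p3p2 p f _ 4≤p _ a b signs Σb≤Σa p^f-1∣Δ =
  periodic-carrySequence⇒≡ 4≤p f a b x signs Σb≤Σa (carries-carrySequence p f c q) periodic
  where
  open ≡-Reasoning
  open _∣_ (∣ᵤ⇒∣ {(+ p) ^ f - 1ℤ} {pexp p f a - pexp p f b} p^f-1∣Δ)
    renaming (quotient to q)
  c : Fin f → ℤ
  c j = a j - b j
  x : Fin (suc f) → ℤ
  x = carries p f c q
  periodic : x zero ≡ x (fromℕ f)
  periodic = begin
    x zero
      ≡⟨ carries-head p f c q ⟩
    (+ p) ^ f * q - pexp p f c
      ≡⟨ cong ((+ p) ^ f * q -_) (pexp-distrib-- p f a b) ⟩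
    (+ p) ^ f * q - (pexp p f a - pexp p f b)
      ≡⟨ cong ((+ p) ^ f * q -_) equality ⟩
    (+ p) ^ f * q - q * ((+ p) ^ f - 1ℤ)
      ≡⟨ P*q-q*[P-1]≡q ((+ p) ^ f) q ⟩
    q
      ≡⟨ carries-last p f c q ⟨
    x (fromℕ f) ∎
    where
    P*q-q*[P-1]≡q : ∀ P q → P * q - q * (P - 1ℤ) ≡ q
    P*q-q*[P-1]≡q = solve-∀
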